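{- For any chip configuration $\sigma$ on $K_n$ and any $j\in[n]$, $a(c^j\sigma)=a(\sigma)$.
   Context: Parallel chip-firing on $K_n$: for integer-valued $\sigma:[n]\to\mathbb{Z}$, $r(\sigma)=\#\{v:\sigma(v)\ge n\}$, $U\sigma(v)=\sigma(v)+r(\sigma)$ if $\sigma(v)\le n-1$, $U\sigma(v)=\sigma(v)-n+r(\sigma)$ if $\sigma(v)\ge n$. The activity is $a(\sigma)=\lim_{t\to\infty}\frac{1}{nt}\sum_{s=0}^{t-1}r(U^s\sigma)$. The conjugate configuration is $c^j\sigma(v)=\sigma(v)+j-n$ for $v\le j$ and $c^j\sigma(v)=\sigma(v)+j$ for $v>j$. -}

module Defs where

open import Data.Nat as ℕ using (ℕ; zero; suc; NonZero)
open import Data.Nat.Properties using (m*n≢0)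
open import Data.Integer as ℤ using (ℤ; +_)
open import Data.Fin using (Fin; toℕ)
open import Data.List using (List; length; filter)
open import Data.List.Base using (allFin)
open import Data.Rational as ℚ using (ℚ)
open import Relation.Nullary using (does)
open import Data.Bool using (if_then_else_)

-- A chip configuration on K_n: vertex v ∈ [n] is represented by
-- (v' : Fin n) with v = toℕ v' + 1.
Config : ℕ → Set
Config n = Fin n → ℤ

r : ∀ {n} → Config n → ℕ
r {n} σ = length (filter (λ v → + n ℤ.≤? σ v) (allFin n))

U : ∀ {n} → Config n → Config n
U {n} σ v =
  if does (+ n ℤ.≤? σ v)
  then (σ v ℤ.- + n) ℤ.+ + r σ
  else σ v ℤ.+ + r σ

iterU : ∀ {n} → ℕ → Config n → Config n
iterU zero    σ = σ
iterU (suc s) σ = U (iterU s σ)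

firings : ∀ {n} → Config n → ℕ → ℕ
firings σ zero    = zero
firings σ (suc t) = firings σ t ℕ.+ r (iterU t σ)

-- the Cesàro average (1/(n t)) Σ_{s=0}^{t-1} r(U^s σ), for t ≥ 1
-- (written with t = suc k to avoid division by zero)
avg : ∀ {n} .{{_ : NonZero n}} → Config n → (k : ℕ) → ℚ
avg {n} σ k = (+ firings σ (suc k)) ℚ./ (n ℕ.* suc k)
  where instance _ = m*n≢0 n (suc k)

conj : ∀ {n} → ℕ → Config n → Config n
conj {n} j σ v =
  if does (suc (toℕ v) ℕ.≤? j)
  then (σ v ℤ.+ + j) ℤ.- + n
  else σ v ℤ.+ + j

{-# OPTIONS --safe #-}
-- For a vertex set D write σ ⊕ D for σ − n·1_D + |D|; then U σ = σ ⊕ F(σ) with F(σ) the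
-- set of firing vertices, and c^j σ = σ ⊕ {1,…,j}. If τ = σ ⊕ D then, as |D| ≤ n, a vertex
-- of D fires in τ only if it fires in σ, and a vertex outside D fires in σ only if it fires
-- in τ. Hence U τ = U σ ⊕ D′ with D′ = D Δ F(σ) Δ F(τ) and |D′| + r(σ) = |D| + r(τ). Iterating,
-- the firings of c^j σ and of σ up to time t differ by |Dₜ| − j ∈ [−n, n], so the two
-- averages differ by at most 1/t.
module Submission where

open import Defs
open import Data.Nat as ℕ using (ℕ; zero; suc; NonZero; z≤n; s≤s)
import Data.Nat.Properties as ℕP
open import Algebra.Properties.CommutativeSemigroup ℕP.+-commutativeSemigroup
  using (interchange; xy∙z≈xz∙y; x∙yz≈xz∙y)
open import Data.Integer as ℤ using (ℤ; +_; -[1+_])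
import Data.Integer.Properties as ℤP
open import Data.Integer.Tactic.RingSolver using (solve-∀)
open import Data.Fin using (Fin; toℕ) renaming (zero to fzero; suc to fsuc)
open import Data.List using (length; filter; tabulate)
open import Data.Bool using (Bool; true; false; T; if_then_else_; _xor_)
open import Relation.Nullary using (does; yes; no; contradiction)
open import Relation.Unary using (Pred; Decidable)
open import Relation.Binary.PropositionalEquality
open import Data.Product using (∃; _×_; _,_)
open import Function using (_∘_)
open import Data.Rational as ℚ using (ℚ; 0ℚ; ∣_∣; mkℚ)
import Data.Rational.Properties as ℚP
open import Data.Rational.Unnormalised as ℚᵘ using (mkℚᵘ; *≡*; *≤*; *<*)
import Data.Rational.Unnormalised.Properties as ℚᵘP

bit : Bool → ℕ
bit false = 0
bit true  = 1

count : ∀ {n} → (Fin n → Bool) → ℕ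
count {zero}  D = 0
count {suc n} D = bit (D fzero) ℕ.+ count (D ∘ fsuc)

count-≤ : ∀ {n} (D : Fin n → Bool) → count D ℕ.≤ n
count-≤ {zero}  D = z≤n
count-≤ {suc n} D with D fzero
... | true  = s≤s (count-≤ (D ∘ fsuc))
... | false = ℕP.m≤n⇒m≤1+n (count-≤ (D ∘ fsuc))

count-balance : ∀ {n} (a b c d : Fin n → Bool) →
  (∀ v → bit (a v) ℕ.+ bit (b v) ≡ bit (c v) ℕ.+ bit (d v)) →
  count a ℕ.+ count b ≡ count c ℕ.+ count d
count-balance {zero}  a b c d eq = refl
count-balance {suc n} a b c d eq = begin
  (bit (a fzero) ℕ.+ count (a ∘ fsuc)) ℕ.+ (bit (b fzero) ℕ.+ count (b ∘ fsuc))
    ≡⟨ interchange (bit (a fzero)) (count (a ∘ fsuc)) (bit (b fzero)) (count (b ∘ fsuc)) ⟩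
  (bit (a fzero) ℕ.+ bit (b fzero)) ℕ.+ (count (a ∘ fsuc) ℕ.+ count (b ∘ fsuc))
    ≡⟨ cong₂ ℕ._+_ (eq fzero) (count-balance (a ∘ fsuc) (b ∘ fsuc) (c ∘ fsuc) (d ∘ fsuc) (eq ∘ fsuc)) ⟩
  (bit (c fzero) ℕ.+ bit (d fzero)) ℕ.+ (count (c ∘ fsuc) ℕ.+ count (d ∘ fsuc))
    ≡⟨ interchange (bit (c fzero)) (count (c ∘ fsuc)) (bit (d fzero)) (count (d ∘ fsuc)) ⟨
  (bit (c fzero) ℕ.+ count (c ∘ fsuc)) ℕ.+ (bit (d fzero) ℕ.+ count (d ∘ fsuc)) ∎
  where open ≡-Reasoning

length-filter-tabulate : ∀ {n} {A : Set} {p} {P : Pred A p} (P? : Decidable P) (f : Fin n → A) →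
  length (filter P? (tabulate f)) ≡ count (λ v → does (P? (f v)))
length-filter-tabulate {zero}  P? f = refl
length-filter-tabulate {suc n} P? f with does (P? (f fzero))
... | true  = cong suc (length-filter-tabulate P? (f ∘ fsuc))
... | false = length-filter-tabulate P? (f ∘ fsuc)

first : ∀ {n} → ℕ → Fin n → Bool
first j v = does (suc (toℕ v) ℕ.≤? j)

count-first : ∀ {n} j → j ℕ.≤ n → count (first {n} j) ≡ j
count-first {zero}  zero    z≤n       = refl
count-first {suc n} zero    z≤n       = count-first {n} zero z≤n
count-first {suc n} (suc j) (s≤s j≤n) = cong suc (count-first j j≤n)

bit-xor : ∀ d f g → (if d then (T g → T f) else (T f → T g)) →
  bit (d xor (f xor g)) ℕ.+ bit f ≡ bit d ℕ.+ bit g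
bit-xor true  true  true  _ = refl
bit-xor true  true  false _ = refl
bit-xor true  false false _ = refl
bit-xor true  false true  g⇒f with () ← g⇒f _
bit-xor false false false _ = refl
bit-xor false false true  _ = refl
bit-xor false true  true  _ = refl
bit-xor false true  false f⇒g with () ← f⇒g _

pos-+-≡ : ∀ a b c d → a ℕ.+ b ≡ c ℕ.+ d → + a ℤ.+ + b ≡ + c ℤ.+ + d
pos-+-≡ a b c d eq = trans (sym (ℤP.pos-+ a b)) (trans (cong +_ eq) (ℤP.pos-+ c d))

rebalance : ∀ (s N : ℤ) (d d′ f g c c′ r r′ : ℕ) → d′ ℕ.+ f ≡ d ℕ.+ g → c′ ℕ.+ r ≡ c ℕ.+ r′ →
  ((s ℤ.- N ℤ.* + d) ℤ.+ + c) ℤ.- N ℤ.* + g ℤ.+ + r′ ≡ ((s ℤ.- N ℤ.* + f) ℤ.+ + r) ℤ.- N ℤ.* + d′ ℤ.+ + c′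
rebalance s N d d′ f g c c′ r r′ eq₁ eq₂ = begin
  ((s ℤ.- N ℤ.* + d) ℤ.+ + c) ℤ.- N ℤ.* + g ℤ.+ + r′
    ≡⟨ regroup s N (+ d) (+ f) (+ g) (+ c) (+ r) (+ r′) ⟩
  ((s ℤ.- N ℤ.* + f) ℤ.+ + r) ℤ.- N ℤ.* ((+ d ℤ.+ + g) ℤ.- + f) ℤ.+ ((+ c ℤ.+ + r′) ℤ.- + r)
    ≡⟨ cong₂ (λ x y → ((s ℤ.- N ℤ.* + f) ℤ.+ + r) ℤ.- N ℤ.* (x ℤ.- + f) ℤ.+ (y ℤ.- + r))
             (pos-+-≡ d′ f d g eq₁) (pos-+-≡ c′ r c r′ eq₂) ⟨
  ((s ℤ.- N ℤ.* + f) ℤ.+ + r) ℤ.- N ℤ.* ((+ d′ ℤ.+ + f) ℤ.- + f) ℤ.+ ((+ c′ ℤ.+ + r) ℤ.- + r)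
    ≡⟨ cancel s N (+ d′) (+ f) (+ c′) (+ r) ⟩
  ((s ℤ.- N ℤ.* + f) ℤ.+ + r) ℤ.- N ℤ.* + d′ ℤ.+ + c′ ∎
  where
  open ≡-Reasoning
  regroup : ∀ s N d f g c r r′ →
    ((s ℤ.- N ℤ.* d) ℤ.+ c) ℤ.- N ℤ.* g ℤ.+ r′ ≡
    ((s ℤ.- N ℤ.* f) ℤ.+ r) ℤ.- N ℤ.* ((d ℤ.+ g) ℤ.- f) ℤ.+ ((c ℤ.+ r′) ℤ.- r)
  regroup = solve-∀
  cancel : ∀ s N d′ f c′ r →
    ((s ℤ.- N ℤ.* f) ℤ.+ r) ℤ.- N ℤ.* ((d′ ℤ.+ f) ℤ.- f) ℤ.+ ((c′ ℤ.+ r) ℤ.- r) ≡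
    ((s ℤ.- N ℤ.* f) ℤ.+ r) ℤ.- N ℤ.* d′ ℤ.+ c′
  cancel = solve-∀

m+n≡o+p⇒+m-+o≡+p-+n : ∀ m n o p → m ℕ.+ n ≡ o ℕ.+ p → + m ℤ.- + o ≡ + p ℤ.- + n
m+n≡o+p⇒+m-+o≡+p-+n m n o p eq = begin
  + m ℤ.- + o                     ≡⟨ add-both (+ m) (+ o) (+ n) ⟩
  (+ m ℤ.+ + n) ℤ.- (+ o ℤ.+ + n) ≡⟨ cong (ℤ._- (+ o ℤ.+ + n)) (pos-+-≡ m n o p eq) ⟩
  (+ o ℤ.+ + p) ℤ.- (+ o ℤ.+ + n) ≡⟨ cancel (+ o) (+ p) (+ n) ⟩
  + p ℤ.- + n                     ∎
  where
  open ≡-Reasoning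
  add-both : ∀ x y z → x ℤ.- y ≡ (x ℤ.+ z) ℤ.- (y ℤ.+ z)
  add-both = solve-∀
  cancel : ∀ x y z → (x ℤ.+ y) ℤ.- (x ℤ.+ z) ≡ y ℤ.- z
  cancel = solve-∀

∣+a-+b∣≤ : ∀ {a b c j n} → a ℕ.+ j ≡ b ℕ.+ c → c ℕ.≤ n → j ℕ.≤ n → ℤ.∣ + a ℤ.- + b ∣ ℕ.≤ n
∣+a-+b∣≤ {a} {b} {c} {j} {n} eq c≤n j≤n = begin
  ℤ.∣ + a ℤ.- + b ∣ ≡⟨ cong ℤ.∣_∣ (m+n≡o+p⇒+m-+o≡+p-+n a j b c eq) ⟩
  ℤ.∣ + c ℤ.- + j ∣ ≡⟨ cong ℤ.∣_∣ (ℤP.m-n≡m⊖n c j) ⟩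
  ℤ.∣ c ℤ.⊖ j ∣     ≤⟨ ℤP.∣m⊝n∣≤m⊔n c j ⟩
  c ℕ.⊔ j           ≤⟨ ℕP.⊔-lub c≤n j≤n ⟩
  n                 ∎
  where open ℕP.≤-Reasoning

fires : ∀ {n} → Config n → Fin n → Bool
fires {n} σ v = does (+ n ℤ.≤? σ v)

fires-mono : ∀ {n} {σ τ : Config n} {v w} → σ v ℤ.≤ τ w → T (fires σ v) → T (fires τ w)
fires-mono {n} {σ} {τ} {v} {w} σv≤τw with + n ℤ.≤? σ v | + n ℤ.≤? τ w
... | _        | yes _   = _
... | no _     | no _    = λ ()
... | yes n≤σv | no n≰τw = contradiction (ℤP.≤-trans n≤σv σv≤τw) n≰τw

r≡count-fires : ∀ {n} (σ : Config n) → r σ ≡ count (fires σ)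
r≡count-fires {n} σ = length-filter-tabulate (λ v → + n ℤ.≤? σ v) (λ v → v)

U-by-fires : ∀ {n} (σ : Config n) v → U σ v ≡ (σ v ℤ.- + n ℤ.* + bit (fires σ v)) ℤ.+ + r σ
U-by-fires {n} σ v with does (+ n ℤ.≤? σ v)
... | true  = cong (λ m → (σ v ℤ.- m) ℤ.+ + r σ) (sym (ℤP.*-identityʳ (+ n)))
... | false = cong (ℤ._+ + r σ) (sym (trans (cong (ℤ._-_ (σ v)) (ℤP.*-zeroʳ (+ n))) (ℤP.+-identityʳ (σ v))))

shift : ∀ {n} → Config n → (Fin n → Bool) → Config n
shift {n} σ D v = (σ v ℤ.- + n ℤ.* + bit (D v)) ℤ.+ + count D

shift-compare : ∀ {n} (σ : Config n) D v → if D v then shift σ D v ℤ.≤ σ v else σ v ℤ.≤ shift σ D v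
shift-compare {n} σ D v with D v
... | true  = begin
  (σ v ℤ.- + n ℤ.* + 1) ℤ.+ + count D ≡⟨ regroup (σ v) (+ n) (+ count D) ⟩
  σ v ℤ.+ (+ count D ℤ.- + n)         ≤⟨ ℤP.+-monoʳ-≤ (σ v) (ℤP.i≤j⇒i-j≤0 (ℤ.+≤+ (count-≤ D))) ⟩
  σ v ℤ.+ ℤ.0ℤ                        ≡⟨ ℤP.+-identityʳ (σ v) ⟩
  σ v                                 ∎
  where
  open ℤP.≤-Reasoning
  regroup : ∀ s N c → (s ℤ.- N ℤ.* + 1) ℤ.+ c ≡ s ℤ.+ (c ℤ.- N)
  regroup = solve-∀
... | false = begin
  σ v                                 ≤⟨ ℤP.i≤i+j (σ v) (+ count D) ⟩
  σ v ℤ.+ + count D                   ≡⟨ regroup (σ v) (+ n) (+ count D) ⟩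
  (σ v ℤ.- + n ℤ.* + 0) ℤ.+ + count D ∎
  where
  open ℤP.≤-Reasoning
  regroup : ∀ s N c → s ℤ.+ c ≡ (s ℤ.- N ℤ.* + 0) ℤ.+ c
  regroup = solve-∀

conj≗shift-first : ∀ {n} (σ : Config n) j → j ℕ.≤ n → conj j σ ≗ shift σ (first j)
conj≗shift-first {n} σ j j≤n v rewrite count-first {n} j j≤n with first {n} j v
... | true  = regroup (σ v) (+ n) (+ j)
  where
  regroup : ∀ s N J → (s ℤ.+ J) ℤ.- N ≡ (s ℤ.- N ℤ.* + 1) ℤ.+ J
  regroup = solve-∀
... | false = regroup (σ v) (+ n) (+ j)
  where
  regroup : ∀ s N J → s ℤ.+ J ≡ (s ℤ.- N ℤ.* + 0) ℤ.+ J
  regroup = solve-∀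

next-shift : ∀ {n} → Config n → Config n → (Fin n → Bool) → Fin n → Bool
next-shift σ τ D v = D v xor (fires σ v xor fires τ v)

shift-U : ∀ {n} (σ τ : Config n) D → τ ≗ shift σ D →
  U τ ≗ shift (U σ) (next-shift σ τ D) × count (next-shift σ τ D) ℕ.+ r σ ≡ count D ℕ.+ r τ
shift-U {n} σ τ D τ≗ = U-step , count-step
  where
  D′ = next-shift σ τ D

  fires-compare : ∀ v → if D v then (T (fires τ v) → T (fires σ v)) else (T (fires σ v) → T (fires τ v))
  fires-compare v with D v | shift-compare σ D v | τ≗ v
  ... | true  | shift≤σ | τv≡shift = fires-mono {σ = τ} {σ} (ℤP.≤-trans (ℤP.≤-reflexive τv≡shift) shift≤σ)
  ... | false | σ≤shift | τv≡shift = fires-mono {σ = σ} {τ} (ℤP.≤-trans σ≤shift (ℤP.≤-reflexive (sym τv≡shift)))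

  balance : ∀ v → bit (D′ v) ℕ.+ bit (fires σ v) ≡ bit (D v) ℕ.+ bit (fires τ v)
  balance v = bit-xor (D v) (fires σ v) (fires τ v) (fires-compare v)

  count-step : count D′ ℕ.+ r σ ≡ count D ℕ.+ r τ
  count-step rewrite r≡count-fires σ | r≡count-fires τ = count-balance D′ (fires σ) D (fires τ) balance

  U-step : U τ ≗ shift (U σ) D′
  U-step v = begin
    U τ v
      ≡⟨ U-by-fires τ v ⟩
    (τ v ℤ.- + n ℤ.* + bit (fires τ v)) ℤ.+ + r τ
      ≡⟨ cong (λ x → (x ℤ.- + n ℤ.* + bit (fires τ v)) ℤ.+ + r τ) (τ≗ v) ⟩
    (shift σ D v ℤ.- + n ℤ.* + bit (fires τ v)) ℤ.+ + r τ
      ≡⟨ rebalance (σ v) (+ n) (bit (D v)) (bit (D′ v)) (bit (fires σ v)) (bit (fires τ v))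
                   (count D) (count D′) (r σ) (r τ) (balance v) count-step ⟩
    ((σ v ℤ.- + n ℤ.* + bit (fires σ v)) ℤ.+ + r σ) ℤ.- + n ℤ.* + bit (D′ v) ℤ.+ + count D′
      ≡⟨ cong (λ x → (x ℤ.- + n ℤ.* + bit (D′ v)) ℤ.+ + count D′) (U-by-fires σ v) ⟨
    shift (U σ) D′ v ∎
    where open ≡-Reasoning

shift-iterU : ∀ {n} (σ τ : Config n) D → τ ≗ shift σ D → ∀ t →
  ∃ λ E → iterU t τ ≗ shift (iterU t σ) E × firings τ t ℕ.+ count D ≡ firings σ t ℕ.+ count E
shift-iterU σ τ D τ≗ zero = D , τ≗ , refl
shift-iterU σ τ D τ≗ (suc t) with shift-iterU σ τ D τ≗ t
... | E , τₜ≗ , firings-t with shift-U (iterU t σ) (iterU t τ) E τₜ≗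
... | τₜ₊₁≗ , count-step = next-shift (iterU t σ) (iterU t τ) E , τₜ₊₁≗ , firings-step
  where
  open ≡-Reasoning
  E′ = next-shift (iterU t σ) (iterU t τ) E
  rσ = r (iterU t σ)
  rτ = r (iterU t τ)
  firings-step : (firings τ t ℕ.+ rτ) ℕ.+ count D ≡ (firings σ t ℕ.+ rσ) ℕ.+ count E′
  firings-step = begin
    (firings τ t ℕ.+ rτ) ℕ.+ count D  ≡⟨ xy∙z≈xz∙y (firings τ t) rτ (count D) ⟩
    (firings τ t ℕ.+ count D) ℕ.+ rτ  ≡⟨ cong (ℕ._+ rτ) firings-t ⟩
    (firings σ t ℕ.+ count E) ℕ.+ rτ  ≡⟨ ℕP.+-assoc (firings σ t) (count E) rτ ⟩
    firings σ t ℕ.+ (count E ℕ.+ rτ)  ≡⟨ cong (firings σ t ℕ.+_) count-step ⟨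
    firings σ t ℕ.+ (count E′ ℕ.+ rσ) ≡⟨ x∙yz≈xz∙y (firings σ t) (count E′) rσ ⟩
    (firings σ t ℕ.+ rσ) ℕ.+ count E′ ∎

firings-conj : ∀ {n} (σ : Config n) j → j ℕ.≤ n → ∀ t →
  ∃ λ c → c ℕ.≤ n × firings (conj j σ) t ℕ.+ j ≡ firings σ t ℕ.+ c
firings-conj {n} σ j j≤n t with shift-iterU σ (conj j σ) (first j) (conj≗shift-first σ j j≤n) t
... | E , _ , firings-t =
  count E , count-≤ E , subst (λ c → firings (conj j σ) t ℕ.+ c ≡ _) (count-first j j≤n) firings-t

mkℚᵘ-sub : ∀ a b m → mkℚᵘ a m ℚᵘ.- mkℚᵘ b m ℚᵘ.≃ mkℚᵘ (a ℤ.- b) m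
mkℚᵘ-sub a b m = *≡* (trans (regroup a b (+ suc m)) (cong ((a ℤ.- b) ℤ.*_) (sym (ℤP.pos-* (suc m) (suc m)))))
  where
  regroup : ∀ a b s → (a ℤ.* s ℤ.+ (ℤ.- b) ℤ.* s) ℤ.* s ≡ (a ℤ.- b) ℤ.* (s ℤ.* s)
  regroup = solve-∀

toℚᵘ-p/d-q/d : ∀ p q m → ℚ.toℚᵘ (p ℚ./ suc m ℚ.- q ℚ./ suc m) ℚᵘ.≃ mkℚᵘ (p ℤ.- q) m
toℚᵘ-p/d-q/d p q m = begin
  ℚ.toℚᵘ (x ℚ.- y)               ≈⟨ ℚP.toℚᵘ-homo-+ x (ℚ.- y) ⟩
  ℚ.toℚᵘ x ℚᵘ.+ ℚ.toℚᵘ (ℚ.- y)   ≈⟨ ℚᵘP.+-congʳ (ℚ.toℚᵘ x) (ℚP.toℚᵘ-homo‿- y) ⟩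
  ℚ.toℚᵘ x ℚᵘ.- ℚ.toℚᵘ y         ≈⟨ ℚᵘP.+-cong (ℚP.toℚᵘ-fromℚᵘ (mkℚᵘ p m)) (ℚᵘP.-‿cong (ℚP.toℚᵘ-fromℚᵘ (mkℚᵘ q m))) ⟩
  mkℚᵘ p m ℚᵘ.- mkℚᵘ q m         ≈⟨ mkℚᵘ-sub p q m ⟩
  mkℚᵘ (p ℤ.- q) m               ∎
  where
  open ℚᵘP.≃-Reasoning
  x = p ℚ./ suc m
  y = q ℚ./ suc m

∣p/d-q/d∣≡∣p-q∣/d : ∀ p q d .{{_ : NonZero d}} → ∣ p ℚ./ d ℚ.- q ℚ./ d ∣ ≡ + ℤ.∣ p ℤ.- q ∣ ℚ./ d
∣p/d-q/d∣≡∣p-q∣/d p q (suc m) = begin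
  ∣ x-y ∣                             ≡⟨ ℚP.fromℚᵘ-toℚᵘ ∣ x-y ∣ ⟨
  ℚ.fromℚᵘ (ℚ.toℚᵘ ∣ x-y ∣)           ≡⟨ ℚP.fromℚᵘ-cong toℚᵘ-∣x-y∣ ⟩
  ℚ.fromℚᵘ (mkℚᵘ (+ ℤ.∣ p ℤ.- q ∣) m) ∎
  where
  open ≡-Reasoning
  x-y = p ℚ./ suc m ℚ.- q ℚ./ suc m
  toℚᵘ-∣x-y∣ : ℚ.toℚᵘ ∣ x-y ∣ ℚᵘ.≃ ℚᵘ.∣ mkℚᵘ (p ℤ.- q) m ∣
  toℚᵘ-∣x-y∣ = ℚᵘP.≃-trans (ℚP.toℚᵘ-homo-∣-∣ x-y) (ℚᵘP.∣-∣-cong (toℚᵘ-p/d-q/d p q m))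

fromℚᵘ-mono-≤ : ∀ {p q} → p ℚᵘ.≤ q → ℚ.fromℚᵘ p ℚ.≤ ℚ.fromℚᵘ q
fromℚᵘ-mono-≤ {p} {q} p≤q = ℚP.toℚᵘ-cancel-≤
  (ℚᵘP.≤-respˡ-≃ (ℚᵘP.≃-sym (ℚP.toℚᵘ-fromℚᵘ p)) (ℚᵘP.≤-respʳ-≃ (ℚᵘP.≃-sym (ℚP.toℚᵘ-fromℚᵘ q)) p≤q))

e/[n*suc-k]≤1/suc-k : ∀ {e n k} → e ℕ.≤ suc n → + e ℚ./ (suc n ℕ.* suc k) ℚ.≤ + 1 ℚ./ suc k
e/[n*suc-k]≤1/suc-k {e} {n′} {k} e≤n = let n = suc n′ in
  fromℚᵘ-mono-≤ {mkℚᵘ (+ e) _} {mkℚᵘ (+ 1) k} (*≤* (subst₂ ℤ._≤_ (ℤP.pos-* e (suc k)) (ℤP.pos-* 1 (n ℕ.* suc k)) (ℤ.+≤+ (begin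
    e ℕ.* suc k       ≤⟨ ℕP.*-monoˡ-≤ (suc k) e≤n ⟩
    n ℕ.* suc k       ≡⟨ ℕP.*-identityˡ (n ℕ.* suc k) ⟨
    1 ℕ.* (n ℕ.* suc k) ∎))))
  where open ℕP.≤-Reasoning

1/suc-k-eventually< : ∀ ε → 0ℚ ℚ.< ε → ∃ λ K → ∀ k → K ℕ.≤ k → + 1 ℚ./ suc k ℚ.< ε
1/suc-k-eventually< (mkℚ (+ suc p) q _) _ = suc q , 1/suc-k<ε
  where
  1/suc-k<ε : ∀ k → suc q ℕ.≤ k → + 1 ℚ./ suc k ℚ.< mkℚ (+ suc p) q _
  1/suc-k<ε k q<k = ℚP.toℚᵘ-cancel-< (ℚᵘP.<-respˡ-≃ (ℚᵘP.≃-sym (ℚP.toℚᵘ-fromℚᵘ (mkℚᵘ (+ 1) k)))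
    (*<* (subst₂ ℤ._<_ (ℤP.pos-* 1 (suc q)) (ℤP.pos-* (suc p) (suc k)) (ℤ.+<+ (begin-strict
      1 ℕ.* suc q     ≡⟨ ℕP.*-identityˡ (suc q) ⟩
      suc q           ≤⟨ q<k ⟩
      k               <⟨ ℕP.n<1+n k ⟩
      suc k           ≤⟨ ℕP.m≤n*m (suc k) (suc p) ⟩
      suc p ℕ.* suc k ∎)))))
    where open ℕP.≤-Reasoning
1/suc-k-eventually< (mkℚ (+ zero)   _ _) 0<ε with () ← ℚ.positive 0<ε
1/suc-k-eventually< (mkℚ -[1+ _ ] _ _) 0<ε with () ← ℚ.positive 0<ε

corollary4p11 : (n : ℕ) .{{_ : NonZero n}} (σ : Config n) (j : ℕ) →
    1 ℕ.≤ j → j ℕ.≤ n →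
    (ε : ℚ) → 0ℚ ℚ.< ε →
    ∃ λ K → (k : ℕ) → K ℕ.≤ k →
      ∣ avg (conj j σ) k ℚ.- avg σ k ∣ ℚ.< ε
corollary4p11 (suc n′) σ j _ j≤n ε 0<ε with 1/suc-k-eventually< ε 0<ε
... | K , 1/suc-k<ε = K , avg-close
  where
  avg-close : ∀ k → K ℕ.≤ k → ∣ avg (conj j σ) k ℚ.- avg σ k ∣ ℚ.< ε
  avg-close k K≤k with firings-conj σ j j≤n (suc k)
  ... | c , c≤n , firings-eq = begin-strict
    ∣ avg (conj j σ) k ℚ.- avg σ k ∣
      ≡⟨ ∣p/d-q/d∣≡∣p-q∣/d (+ firings (conj j σ) (suc k)) (+ firings σ (suc k)) (suc n′ ℕ.* suc k) ⟩
    + ℤ.∣ + firings (conj j σ) (suc k) ℤ.- + firings σ (suc k) ∣ ℚ./ (suc n′ ℕ.* suc k)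
      ≤⟨ e/[n*suc-k]≤1/suc-k (∣+a-+b∣≤ firings-eq c≤n j≤n) ⟩
    + 1 ℚ./ suc k
      <⟨ 1/suc-k<ε k K≤k ⟩
    ε ∎
    where open ℚP.≤-Reasoning
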